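{- Let $i,j$ be positive integers, let $(\tilde p^1,\tilde p^2,\tilde p^3)\in\mathcal P_{i,j}$ and let $w$ be the word constructed from it as in the context. Then $w$ is the unique word on $\{e,\bar e,b,\bar b\}$ that is compatible with $(\tilde p^1,\tilde p^2,\tilde p^3)$ and satisfies the following five conditions: (1) $w_1=e$ and $w_2=b$; (2) $w_{|e,\bar e}$ is a Dyck word; (3) $w_{|b,\bar b}$ is a Dyck word; (4) for all $i'<j'$, if $w_{i'}=b$ and $w_{j'}=\bar b$ then $w_k=\bar e$ for some $k\in[i',j']$; (5) for all $1<i'<j'$, if $w_{i'}=e$ and $w_{j'}=\bar e$ then $w_k=\bar b$ for some $k\in[i',j']$.
   Context: $\mathcal P_{i,j}$ is the set of triples $(\tilde p^1,\tilde p^2,\tilde p^3)$ of lattice paths, each with $i$ right-steps $(1,0)$ and $j$ up-steps $(0,1)$, starting at $(-1,1)$, $(0,0)$, $(1,-1)$ respectively, such that no point of $\mathbb Z^2$ lies on two of them. Encode $\tilde p^1$ as a word $\tilde w^1$ over $\{e,\bar b\}$ ($e$ = up, $\bar b$ = right), $\tilde p^2$ as $\tilde w^2$ over $\{\bar e,\bar b\}$ ($\bar e$ = up, $\bar b$ = right), $\tilde p^3$ as $\tilde w^3$ over $\{\bar e,b\}$ ($\bar e$ = up, $b$ = right). Set $w^1=e\,\tilde w^1\,\bar b$, $w^2=\bar e\,\bar b\,\tilde w^2$, $w^3=b\,\tilde w^3\,\bar e$. Write $w^1=e\cdot u_1u_2\cdots u_r$ where each factor $u_k$ has the form $e^{a}\bar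 b$ ($a\ge0$), and $w^3=b\cdot v_1v_2\cdots v_s$ where each $v_k$ has the form $b^{a}\bar e$. Let $\bar w$ be obtained from $w^2$ by replacing its $k$-th occurrence of $\bar b$ by $u_k$ and its $k$-th occurrence of $\bar e$ by $v_k$, for all $k$, and set $w=e\,b\,\bar w$. A word $w'$ is compatible with the triple if $w'_{|e,\bar b}=w^1$, $w'_{|\bar e,\bar b}=w^2$ and $w'_{|\bar e,b}=w^3$, where $x_{|S}$ denotes the subword of $x$ keeping only the letters in $S$. Dyck words for $\{e,\bar e\}$ (resp. $\{b,\bar b\}$) take $e$ (resp. $b$) as the up step. -}

module Defs where

open import Data.Bool using (Bool; true; false; if_then_else_)
open import Data.Nat using (ℕ; zero; suc; _≤_; _<_)
open import Data.Integer using (ℤ; +_; -[1+_]) renaming (_+_ to _+ℤ_)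
open import Data.Fin using (Fin; toℕ)
open import Data.List using (List; []; _∷_; _++_; [_]; map; length; take; lookup)
open import Data.List.Membership.Propositional using (_∈_)
open import Data.Product using (_×_; _,_; ∃; ∃-syntax)
open import Data.Empty using (⊥)
open import Relation.Binary.PropositionalEquality using (_≡_)

data Step : Set where
  up right : Step

countUp : List Step → ℕ
countUp [] = 0
countUp (up ∷ s) = suc (countUp s)
countUp (right ∷ s) = countUp s

countRight : List Step → ℕ
countRight [] = 0
countRight (up ∷ s) = countRight s
countRight (right ∷ s) = suc (countRight s)

points : ℤ × ℤ → List Step → List (ℤ × ℤ)
points (x , y) [] = (x , y) ∷ []
points (x , y) (up ∷ s) = (x , y) ∷ points (x , y +ℤ + 1) s
points (x , y) (right ∷ s) = (x , y) ∷ points (x +ℤ + 1 , y) s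

Disjoint : List (ℤ × ℤ) → List (ℤ × ℤ) → Set
Disjoint A B = ∀ pt → pt ∈ A → pt ∈ B → ⊥

start1 start2 start3 : ℤ × ℤ
start1 = (-[1+ 0 ] , + 1)
start2 = (+ 0 , + 0)
start3 = (+ 1 , -[1+ 0 ])

record InP (i j : ℕ) (p1 p2 p3 : List Step) : Set where
  field
    right1 : countRight p1 ≡ i
    up1    : countUp p1 ≡ j
    right2 : countRight p2 ≡ i
    up2    : countUp p2 ≡ j
    right3 : countRight p3 ≡ i
    up3    : countUp p3 ≡ j
    disj12 : Disjoint (points start1 p1) (points start2 p2)
    disj13 : Disjoint (points start1 p1) (points start3 p3)
    disj23 : Disjoint (points start2 p2) (points start3 p3)

data Letter : Set where
  e ē b b̄ : Letter

Word : Set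
Word = List Letter

enc1 : Step → Letter
enc1 up = e
enc1 right = b̄

enc2 : Step → Letter
enc2 up = ē
enc2 right = b̄

enc3 : Step → Letter
enc3 up = ē
enc3 right = b

w¹ : List Step → Word
w¹ p = e ∷ (map enc1 p ++ [ b̄ ])

w² : List Step → Word
w² p = ē ∷ b̄ ∷ map enc2 p

w³ : List Step → Word
w³ p = b ∷ (map enc3 p ++ [ ē ])

isB̄ : Letter → Bool
isB̄ b̄ = true
isB̄ _ = false

isĒ : Letter → Bool
isĒ ē = true
isĒ _ = false

-- Split a word into consecutive factors, each ending right after a
-- letter satisfying the predicate (a trailing unterminated part, if
-- any, forms a last factor).
factors : (Letter → Bool) → Word → List Word
factors t [] = []
factors t (c ∷ cs) with t c | factors t cs
... | true  | fs = (c ∷ []) ∷ fs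
... | false | [] = (c ∷ []) ∷ []
... | false | f ∷ fs = (c ∷ f) ∷ fs

-- w¹ = e · u₁ ⋯ u_r ,  u_k = e^a b̄
uFactors : List Step → List Word
uFactors p = factors isB̄ (map enc1 p ++ [ b̄ ])

-- w³ = b · v₁ ⋯ v_s ,  v_k = b^a ē
vFactors : List Step → List Word
vFactors p = factors isĒ (map enc3 p ++ [ ē ])

substitute : Word → List Word → List Word → Word
substitute [] us vs = []
substitute (b̄ ∷ xs) (u ∷ us) vs = u ++ substitute xs us vs
substitute (ē ∷ xs) us (v ∷ vs) = v ++ substitute xs us vs
substitute (x ∷ xs) us vs = x ∷ substitute xs us vs

wbar : List Step → List Step → List Step → Word
wbar p1 p2 p3 = substitute (w² p2) (uFactors p1) (vFactors p3)

wOf : List Step → List Step → List Step → Word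
wOf p1 p2 p3 = e ∷ b ∷ wbar p1 p2 p3

inEB̄ : Letter → Bool
inEB̄ e = true
inEB̄ b̄ = true
inEB̄ _ = false

inĒB̄ : Letter → Bool
inĒB̄ ē = true
inĒB̄ b̄ = true
inĒB̄ _ = false

inĒB : Letter → Bool
inĒB ē = true
inĒB b = true
inĒB _ = false

inEĒ : Letter → Bool
inEĒ e = true
inEĒ ē = true
inEĒ _ = false

inBB̄ : Letter → Bool
inBB̄ b = true
inBB̄ b̄ = true
inBB̄ _ = false

restrict : (Letter → Bool) → Word → Word
restrict S [] = []
restrict S (x ∷ xs) = if S x then x ∷ restrict S xs else restrict S xs

Compatible : List Step → List Step → List Step → Word → Set
Compatible p1 p2 p3 w′ =
  (restrict inEB̄ w′ ≡ w¹ p1) × (restrict inĒB̄ w′ ≡ w² p2) × (restrict inĒB w′ ≡ w³ p3)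

eqL : Letter → Letter → Bool
eqL e e = true
eqL ē ē = true
eqL b b = true
eqL b̄ b̄ = true
eqL _ _ = false

count : Letter → Word → ℕ
count x [] = 0
count x (y ∷ ys) = if eqL x y then suc (count x ys) else count x ys

IsDyck : Letter → Letter → Word → Set
IsDyck u d w =
  (∀ x → x ∈ w → (x ≡ u) Data.Sum.⊎ (x ≡ d)) ×
  (count u w ≡ count d w) ×
  (∀ n → count d (take n w) ≤ count u (take n w))
  where import Data.Sum

-- The five conditions (positions are 0-based here; paper is 1-based)

Cond1 : Word → Set
Cond1 w = ∃[ rest ] (w ≡ e ∷ b ∷ rest)

Cond2 : Word → Set
Cond2 w = IsDyck e ē (restrict inEĒ w)

Cond3 : Word → Set
Cond3 w = IsDyck b b̄ (restrict inBB̄ w)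

Cond4 : Word → Set
Cond4 w = ∀ (p q : Fin (length w)) → toℕ p < toℕ q →
  lookup w p ≡ b → lookup w q ≡ b̄ →
  ∃[ k ] (toℕ p ≤ toℕ k × toℕ k ≤ toℕ q × lookup w k ≡ ē)

-- 1 < i' in 1-based indexing means 1 ≤ toℕ p in 0-based indexing
Cond5 : Word → Set
Cond5 w = ∀ (p q : Fin (length w)) → 1 ≤ toℕ p → toℕ p < toℕ q →
  lookup w p ≡ e → lookup w q ≡ ē →
  ∃[ k ] (toℕ p ≤ toℕ k × toℕ k ≤ toℕ q × lookup w k ≡ b̄)

Good : List Step → List Step → List Step → Word → Set
Good p1 p2 p3 w′ =
  Compatible p1 p2 p3 w′ × Cond1 w′ × Cond2 w′ × Cond3 w′ × Cond4 w′ × Cond5 w′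

-- Call a word blocked if every e is closed by a b̄ before the next ē and every b
-- by an ē before the next b̄.  A blocked word is determined by its restrictions: it is the
-- substitution of the factors of its {e, b̄}- and {ē, b}-restrictions into its {ē, b̄}-restriction,
-- which is how w is built from w¹, w³ and w².  For uniqueness, the Dyck conditions (2), (3) give
-- every e a later ē and every b a later b̄, and conditions (4), (5) say that a b̄ resp. an ē
-- comes first, so any compatible word satisfying (1)-(5) is blocked, hence equal to w.  For
-- existence, w is blocked and compatible by construction; its {e, ē}-restriction records the
-- vertical gap between p̃¹ and p̃² column by column, which stays positive because the paths do not
-- meet, and symmetrically its {b, b̄}-restriction records the horizontal gap between p̃³ and p̃².

module Submission where

open import Defs
open import Data.Bool using (Bool; true; false)
open import Data.Nat using (ℕ; zero; suc; _+_; _≤_; _<_; z≤n; s≤s)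
open import Data.Nat.Properties
  using (+-suc; +-comm; +-identityʳ; suc-injective; +-cancelˡ-≤; +-monoˡ-≤; ≤-trans; module ≤-Reasoning)
open import Data.Integer using (ℤ; +_; -[1+_]) renaming (_+_ to _+ℤ_)
import Data.Integer.Properties as ℤ
open import Data.Fin using (Fin; toℕ; zero; suc)
open import Data.List using (List; []; _∷_; _++_; [_]; map; length; take; drop; lookup; concat)
open import Data.List.Properties using (++-assoc; ∷-injectiveʳ)
open import Data.List.Relation.Unary.All as All using (All; []; _∷_)
open import Data.List.Relation.Unary.All.Properties using (drop⁺)
open import Data.List.Membership.Propositional using (_∈_)
open import Data.List.Relation.Unary.Any using (here; there)
open import Data.Product using (_×_; _,_; ∃-syntax; map₁; uncurry)
open import Data.Sum using (_⊎_; inj₁; inj₂)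
open import Data.Empty using (⊥; ⊥-elim)
open import Data.Unit using (⊤; tt)
open import Relation.Binary.PropositionalEquality
  using (_≡_; refl; sym; trans; cong; cong₂; subst; subst₂; module ≡-Reasoning)

eqL-refl : ∀ x → eqL x x ≡ true
eqL-refl e = refl
eqL-refl ē = refl
eqL-refl b = refl
eqL-refl b̄ = refl

restrict-++ : ∀ S (xs ys : Word) → restrict S (xs ++ ys) ≡ restrict S xs ++ restrict S ys
restrict-++ S [] ys = refl
restrict-++ S (x ∷ xs) ys with S x
... | true  = cong (x ∷_) (restrict-++ S xs ys)
... | false = restrict-++ S xs ys

count-++ : ∀ x (xs ys : Word) → count x (xs ++ ys) ≡ count x xs + count x ys
count-++ x [] ys = refl
count-++ x (y ∷ xs) ys with eqL x y
... | true  = cong suc (count-++ x xs ys)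
... | false = count-++ x xs ys

take-length-++ : ∀ {A : Set} (xs ys : List A) → take (length xs) (xs ++ ys) ≡ xs
take-length-++ [] ys = refl
take-length-++ (x ∷ xs) ys = cong (x ∷_) (take-length-++ xs ys)

-- Dyck words

dyck-suffix : ∀ {u d} xs ys → IsDyck u d (xs ++ ys) → count u ys ≤ count d ys
dyck-suffix {u} {d} xs ys (_ , balanced , prefix) = +-cancelˡ-≤ (count u xs) _ _ (begin
    count u xs + count u ys ≡⟨ count-++ u xs ys ⟨
    count u (xs ++ ys)      ≡⟨ balanced ⟩
    count d (xs ++ ys)      ≡⟨ count-++ d xs ys ⟩
    count d xs + count d ys ≤⟨ +-monoˡ-≤ (count d ys) prefix-xs ⟩
    count u xs + count d ys ∎)
  where
  open ≤-Reasoning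
  prefix-xs : count d xs ≤ count u xs
  prefix-xs = subst (λ ws → count d ws ≤ count u ws) (take-length-++ xs ys) (prefix (length xs))

dyck-answered : ∀ {u d} S → S u ≡ true → eqL d u ≡ false →
  ∀ A X → IsDyck u d (restrict S (A ++ u ∷ X)) → 0 < count d (restrict S X)
dyck-answered {u} {d} S Su d≢u A X dyck = ≤-trans (s≤s z≤n) (subst₂ _≤_ count-u count-d suffix)
  where
  suffix : count u (restrict S (u ∷ X)) ≤ count d (restrict S (u ∷ X))
  suffix = dyck-suffix (restrict S A) _ (subst (IsDyck u d) (restrict-++ S A (u ∷ X)) dyck)
  count-u : count u (restrict S (u ∷ X)) ≡ suc (count u (restrict S X))
  count-u rewrite Su | eqL-refl u = refl
  count-d : count d (restrict S (u ∷ X)) ≡ count d (restrict S X)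
  count-d rewrite Su | d≢u = refl

FollowedBy : (Letter → Bool) → Letter → Letter → Word → Set
FollowedBy S u d [] = ⊤
FollowedBy S u d (x ∷ X) = (x ≡ u → 0 < count d (restrict S X)) × FollowedBy S u d X

dyck-followedBy : ∀ {u d} S → S u ≡ true → eqL d u ≡ false →
  ∀ A X → IsDyck u d (restrict S (A ++ X)) → FollowedBy S u d X
dyck-followedBy S Su d≢u A [] dyck = tt
dyck-followedBy {u} {d} S Su d≢u A (x ∷ X) dyck =
  answered , dyck-followedBy S Su d≢u (A ++ [ x ]) X dyck′
  where
  answered : x ≡ u → 0 < count d (restrict S X)
  answered refl = dyck-answered S Su d≢u A X dyck
  dyck′ : IsDyck u d (restrict S ((A ++ [ x ]) ++ X))
  dyck′ = subst (λ ws → IsDyck u d (restrict S ws)) (sym (++-assoc A [ x ] X)) dyck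

data DyckFrom (u d : Letter) : ℕ → Word → Set where
  []   : DyckFrom u d 0 []
  rise : ∀ {h w} → DyckFrom u d (suc h) w → DyckFrom u d h (u ∷ w)
  fall : ∀ {h w} → DyckFrom u d h w → DyckFrom u d (suc h) (d ∷ w)

dyckFrom-letters : ∀ {u d h w} → DyckFrom u d h w → ∀ x → x ∈ w → x ≡ u ⊎ x ≡ d
dyckFrom-letters (rise _) x (here refl) = inj₁ refl
dyckFrom-letters (fall _) x (here refl) = inj₂ refl
dyckFrom-letters (rise p) x (there x∈w) = dyckFrom-letters p x x∈w
dyckFrom-letters (fall p) x (there x∈w) = dyckFrom-letters p x x∈w

module _ {u d : Letter} (u≢d : eqL u d ≡ false) (d≢u : eqL d u ≡ false) where

  dyckFrom-balance : ∀ {h w} → DyckFrom u d h w → h + count u w ≡ count d w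
  dyckFrom-balance [] = refl
  dyckFrom-balance {h} (rise {w = w} p)
    rewrite eqL-refl u | d≢u | +-suc h (count u w) = dyckFrom-balance p
  dyckFrom-balance (fall p) rewrite u≢d | eqL-refl d = cong suc (dyckFrom-balance p)

  dyckFrom-prefix : ∀ {h w} → DyckFrom u d h w → ∀ n → count d (take n w) ≤ h + count u (take n w)
  dyckFrom-prefix p zero = z≤n
  dyckFrom-prefix [] (suc n) = z≤n
  dyckFrom-prefix {h} (rise {w = w} p) (suc n)
    rewrite eqL-refl u | d≢u | +-suc h (count u (take n w)) = dyckFrom-prefix p n
  dyckFrom-prefix (fall p) (suc n) rewrite u≢d | eqL-refl d = s≤s (dyckFrom-prefix p n)

  dyckFrom-isDyck : ∀ {w} → DyckFrom u d 0 w → IsDyck u d w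
  dyckFrom-isDyck p = dyckFrom-letters p , dyckFrom-balance p , dyckFrom-prefix p

-- Blocked words

-- Cond4 w unfolds to Separated b b̄ ē w.
Separated : Letter → Letter → Letter → Word → Set
Separated x y z w = ∀ (p q : Fin (length w)) → toℕ p < toℕ q →
  lookup w p ≡ x → lookup w q ≡ y → ∃[ k ] (toℕ p ≤ toℕ k × toℕ k ≤ toℕ q × lookup w k ≡ z)

PrecededBy : Letter → Letter → Word → Set
PrecededBy y z w = ∀ (q : Fin (length w)) → lookup w q ≡ y → ∃[ k ] (toℕ k ≤ toℕ q × lookup w k ≡ z)

separated-∷⁻ : ∀ {x y z a X} → Separated x y z (a ∷ X) → Separated x y z X
separated-∷⁻ sep p q p<q lp lq with sep (suc p) (suc q) (s≤s p<q) lp lq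
... | suc k , s≤s p≤k , s≤s k≤q , lk = k , p≤k , k≤q , lk

separated-∷ : ∀ {x y z a X} → (a ≡ x → PrecededBy y z X) → Separated x y z X → Separated x y z (a ∷ X)
separated-∷ pre sep zero (suc q) _ la lq with pre la q lq
... | k , k≤q , lk = suc k , z≤n , s≤s k≤q , lk
separated-∷ pre sep (suc p) (suc q) (s≤s p<q) lp lq with sep p q p<q lp lq
... | k , p≤k , k≤q , lk = suc k , s≤s p≤k , s≤s k≤q , lk

separated-head : ∀ {x y z X} → (x ≡ z → ⊥) → Separated x y z (x ∷ X) → PrecededBy y z X
separated-head x≢z sep q lq with sep zero (suc q) (s≤s z≤n) refl lq
... | zero  , _ , _ , x≡z = ⊥-elim (x≢z x≡z)
... | suc k , _ , s≤s k≤q , lk = k , k≤q , lk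

preceded-∷⁻ : ∀ {y z a X} → (a ≡ z → ⊥) → PrecededBy y z (a ∷ X) → PrecededBy y z X
preceded-∷⁻ a≢z pre q lq with pre (suc q) lq
... | zero  , _ , a≡z = ⊥-elim (a≢z a≡z)
... | suc k , s≤s k≤q , lk = k , k≤q , lk

cond5-∷ : ∀ {a X} → Separated e ē b̄ X → Cond5 (a ∷ X)
cond5-∷ sep (suc p) (suc q) _ (s≤s p<q) lp lq with sep p q p<q lp lq
... | k , p≤k , k≤q , lk = suc k , s≤s p≤k , s≤s k≤q , lk

cond5-∷⁻ : ∀ {a X} → Cond5 (a ∷ X) → Separated e ē b̄ X
cond5-∷⁻ c5 p q p<q lp lq with c5 (suc p) (suc q) (s≤s z≤n) (s≤s p<q) lp lq
... | suc k , s≤s p≤k , s≤s k≤q , lk = k , p≤k , k≤q , lk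

data Opener : Letter → Set where
  e-opens : Opener e
  b-opens : Opener b

data ClosedBy (z : Letter) : Word → Set where
  immediately : ∀ {w} → ClosedBy z (z ∷ w)
  later       : ∀ {o w} → Opener o → ClosedBy z w → ClosedBy z (o ∷ w)

closedBy-preceded : ∀ {y z X} → (Opener y → ⊥) → ClosedBy z X → PrecededBy y z X
closedBy-preceded _ immediately q _ = zero , z≤n , refl
closedBy-preceded y-closes (later o _) zero refl = ⊥-elim (y-closes o)
closedBy-preceded y-closes (later _ c) (suc q) lq with closedBy-preceded y-closes c q lq
... | k , k≤q , lk = suc k , s≤s k≤q , lk

closedBy-b̄ : ∀ X → PrecededBy ē b̄ X → 0 < count ē (restrict inEĒ X) → ClosedBy b̄ X
closedBy-b̄ (b̄ ∷ X) _ _ = immediately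
closedBy-b̄ (ē ∷ X) pre _ with pre zero refl
... | zero , _ , ()
closedBy-b̄ (e ∷ X) pre n = later e-opens (closedBy-b̄ X (preceded-∷⁻ (λ ()) pre) n)
closedBy-b̄ (b ∷ X) pre n = later b-opens (closedBy-b̄ X (preceded-∷⁻ (λ ()) pre) n)

closedBy-ē : ∀ X → PrecededBy b̄ ē X → 0 < count b̄ (restrict inBB̄ X) → ClosedBy ē X
closedBy-ē (ē ∷ X) _ _ = immediately
closedBy-ē (b̄ ∷ X) pre _ with pre zero refl
... | zero , _ , ()
closedBy-ē (e ∷ X) pre n = later e-opens (closedBy-ē X (preceded-∷⁻ (λ ()) pre) n)
closedBy-ē (b ∷ X) pre n = later b-opens (closedBy-ē X (preceded-∷⁻ (λ ()) pre) n)

data Blocked : Word → Set where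
  []      : Blocked []
  open-e  : ∀ {w} → ClosedBy b̄ w → Blocked w → Blocked (e ∷ w)
  open-b  : ∀ {w} → ClosedBy ē w → Blocked w → Blocked (b ∷ w)
  close-ē : ∀ {w} → Blocked w → Blocked (ē ∷ w)
  close-b̄ : ∀ {w} → Blocked w → Blocked (b̄ ∷ w)

blocked-separated-b : ∀ {X} → Blocked X → Separated b b̄ ē X
blocked-separated-b [] ()
blocked-separated-b (open-e _ bl) = separated-∷ (λ ()) (blocked-separated-b bl)
blocked-separated-b (open-b c bl) =
  separated-∷ (λ _ → closedBy-preceded (λ ()) c) (blocked-separated-b bl)
blocked-separated-b (close-ē bl) = separated-∷ (λ ()) (blocked-separated-b bl)
blocked-separated-b (close-b̄ bl) = separated-∷ (λ ()) (blocked-separated-b bl)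

blocked-separated-e : ∀ {X} → Blocked X → Separated e ē b̄ X
blocked-separated-e [] ()
blocked-separated-e (open-e c bl) =
  separated-∷ (λ _ → closedBy-preceded (λ ()) c) (blocked-separated-e bl)
blocked-separated-e (open-b _ bl) = separated-∷ (λ ()) (blocked-separated-e bl)
blocked-separated-e (close-ē bl) = separated-∷ (λ ()) (blocked-separated-e bl)
blocked-separated-e (close-b̄ bl) = separated-∷ (λ ()) (blocked-separated-e bl)

separated-blocked : ∀ {X} → Separated b b̄ ē X → Separated e ē b̄ X →
  FollowedBy inEĒ e ē X → FollowedBy inBB̄ b b̄ X → Blocked X
separated-blocked {[]} _ _ _ _ = []
separated-blocked {e ∷ X} sb se (fe , fes) (_ , fbs) =
  open-e (closedBy-b̄ X (separated-head (λ ()) se) (fe refl))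
         (separated-blocked (separated-∷⁻ sb) (separated-∷⁻ se) fes fbs)
separated-blocked {b ∷ X} sb se (_ , fes) (fb , fbs) =
  open-b (closedBy-ē X (separated-head (λ ()) sb) (fb refl))
         (separated-blocked (separated-∷⁻ sb) (separated-∷⁻ se) fes fbs)
separated-blocked {ē ∷ X} sb se (_ , fes) (_ , fbs) =
  close-ē (separated-blocked (separated-∷⁻ sb) (separated-∷⁻ se) fes fbs)
separated-blocked {b̄ ∷ X} sb se (_ , fes) (_ , fbs) =
  close-b̄ (separated-blocked (separated-∷⁻ sb) (separated-∷⁻ se) fes fbs)

consHead : Letter → List Word → List Word
consHead c [] = [ c ] ∷ []
consHead c (f ∷ fs) = (c ∷ f) ∷ fs

factors-∷ : ∀ t c cs → t c ≡ false → factors t (c ∷ cs) ≡ consHead c (factors t cs)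
factors-∷ t c cs tc with t c | factors t cs
factors-∷ t c cs refl | false | []     = refl
factors-∷ t c cs refl | false | f ∷ fs = refl

concat-factors : ∀ t w → concat (factors t w) ≡ w
concat-factors t [] = refl
concat-factors t (c ∷ cs) with t c | factors t cs | concat-factors t cs
... | true  | fs     | ih = cong (c ∷_) ih
... | false | []     | ih = cong (c ∷_) ih
... | false | f ∷ fs | ih = cong (c ∷_) ih

factors-nonempty : ∀ t c cs → ∃[ f ] ∃[ fs ] factors t (c ∷ cs) ≡ f ∷ fs
factors-nonempty t c cs with t c | factors t cs
... | true  | fs     = _ , _ , refl
... | false | []     = _ , _ , refl
... | false | f ∷ fs = _ , _ , refl

closedBy-restrict-ĒB̄ : ∀ {z X} → inĒB̄ z ≡ true → ClosedBy z X → ∃[ R ] restrict inĒB̄ X ≡ z ∷ R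
closedBy-restrict-ĒB̄ z∈ĒB̄ (immediately {w}) rewrite z∈ĒB̄ = restrict inĒB̄ w , refl
closedBy-restrict-ĒB̄ z∈ĒB̄ (later e-opens c) = closedBy-restrict-ĒB̄ z∈ĒB̄ c
closedBy-restrict-ĒB̄ z∈ĒB̄ (later b-opens c) = closedBy-restrict-ĒB̄ z∈ĒB̄ c

closedBy-factors : ∀ {z X} t S → S z ≡ true → ClosedBy z X →
  ∃[ f ] ∃[ fs ] factors t (restrict S X) ≡ f ∷ fs
closedBy-factors t S z∈S (immediately {w}) rewrite z∈S = factors-nonempty t _ (restrict S w)
closedBy-factors t S z∈S (later {o} {w} _ c) with S o
... | true  = factors-nonempty t o (restrict S w)
... | false = closedBy-factors t S z∈S c

substitute-open-e : ∀ {W R f fs} Y V → W ≡ b̄ ∷ R → factors isB̄ Y ≡ f ∷ fs →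
  substitute W (factors isB̄ (e ∷ Y)) V ≡ e ∷ substitute W (factors isB̄ Y) V
substitute-open-e Y V refl fY rewrite factors-∷ isB̄ e Y refl | fY = refl

substitute-open-b : ∀ {W R f fs} Y U → W ≡ ē ∷ R → factors isĒ Y ≡ f ∷ fs →
  substitute W U (factors isĒ (b ∷ Y)) ≡ b ∷ substitute W U (factors isĒ Y)
substitute-open-b Y U refl fY rewrite factors-∷ isĒ b Y refl | fY = refl

substitute-restrictions : ∀ {X} → Blocked X →
  substitute (restrict inĒB̄ X) (factors isB̄ (restrict inEB̄ X)) (factors isĒ (restrict inĒB X)) ≡ X
substitute-restrictions [] = refl
substitute-restrictions (close-ē bl) = cong (ē ∷_) (substitute-restrictions bl)
substitute-restrictions (close-b̄ bl) = cong (b̄ ∷_) (substitute-restrictions bl)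
substitute-restrictions {e ∷ X} (open-e c bl)
  with _ , W≡ ← closedBy-restrict-ĒB̄ refl c | _ , _ , fY ← closedBy-factors isB̄ inEB̄ refl c =
  trans (substitute-open-e (restrict inEB̄ X) _ W≡ fY) (cong (e ∷_) (substitute-restrictions bl))
substitute-restrictions {b ∷ X} (open-b c bl)
  with _ , W≡ ← closedBy-restrict-ĒB̄ refl c | _ , _ , fY ← closedBy-factors isĒ inĒB refl c =
  trans (substitute-open-b (restrict inĒB X) _ W≡ fY) (cong (b ∷_) (substitute-restrictions bl))

good-unique : ∀ {p1 p2 p3 w′} → Good p1 p2 p3 w′ → w′ ≡ wOf p1 p2 p3
good-unique {p1} {p2} {p3} ((c1 , c2 , c3) , (X , refl) , dyckE , dyckB , c4 , c5) =
  cong (λ W → e ∷ b ∷ W) (begin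
    X
      ≡⟨ substitute-restrictions blocked ⟨
    substitute (restrict inĒB̄ X) (factors isB̄ (restrict inEB̄ X)) (factors isĒ (restrict inĒB X))
      ≡⟨ cong (λ (W , U , V) → substitute W (factors isB̄ U) (factors isĒ V)) restrictions ⟩
    wbar p1 p2 p3 ∎)
  where
  open ≡-Reasoning
  restrictions : (restrict inĒB̄ X , restrict inEB̄ X , restrict inĒB X)
               ≡ (w² p2 , map enc1 p1 ++ [ b̄ ] , map enc3 p3 ++ [ ē ])
  restrictions = cong₂ _,_ c2 (cong₂ _,_ (∷-injectiveʳ c1) (∷-injectiveʳ c3))
  blocked : Blocked X
  blocked = separated-blocked (separated-∷⁻ (separated-∷⁻ c4)) (separated-∷⁻ (cond5-∷⁻ c5))
    (dyck-followedBy inEĒ refl refl (e ∷ b ∷ []) X dyckE)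
    (dyck-followedBy inBB̄ refl refl (e ∷ b ∷ []) X dyckB)

-- Substitution of factors

data UFactor : Word → Set where
  b̄-end  : UFactor [ b̄ ]
  e-step : ∀ {u} → UFactor u → UFactor (e ∷ u)

data VFactor : Word → Set where
  ē-end  : VFactor [ ē ]
  b-step : ∀ {v} → VFactor v → VFactor (b ∷ v)

uFactor-EB̄ : ∀ {u} → UFactor u → ∀ T → restrict inEB̄ (u ++ T) ≡ u ++ restrict inEB̄ T
uFactor-EB̄ b̄-end T = refl
uFactor-EB̄ (e-step f) T = cong (e ∷_) (uFactor-EB̄ f T)

uFactor-ĒB̄ : ∀ {u} → UFactor u → ∀ T → restrict inĒB̄ (u ++ T) ≡ b̄ ∷ restrict inĒB̄ T
uFactor-ĒB̄ b̄-end T = refl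
uFactor-ĒB̄ (e-step f) T = uFactor-ĒB̄ f T

uFactor-ĒB : ∀ {u} → UFactor u → ∀ T → restrict inĒB (u ++ T) ≡ restrict inĒB T
uFactor-ĒB b̄-end T = refl
uFactor-ĒB (e-step f) T = uFactor-ĒB f T

uFactor-BB̄ : ∀ {u} → UFactor u → ∀ T → restrict inBB̄ (u ++ T) ≡ b̄ ∷ restrict inBB̄ T
uFactor-BB̄ b̄-end T = refl
uFactor-BB̄ (e-step f) T = uFactor-BB̄ f T

uFactor-closedBy : ∀ {u} → UFactor u → ∀ {T} → ClosedBy b̄ (u ++ T)
uFactor-closedBy b̄-end = immediately
uFactor-closedBy (e-step f) = later e-opens (uFactor-closedBy f)

uFactor-blocked : ∀ {u} → UFactor u → ∀ {T} → Blocked T → Blocked (u ++ T)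
uFactor-blocked b̄-end bl = close-b̄ bl
uFactor-blocked (e-step f) bl = open-e (uFactor-closedBy f) (uFactor-blocked f bl)

vFactor-ĒB : ∀ {v} → VFactor v → ∀ T → restrict inĒB (v ++ T) ≡ v ++ restrict inĒB T
vFactor-ĒB ē-end T = refl
vFactor-ĒB (b-step f) T = cong (b ∷_) (vFactor-ĒB f T)

vFactor-ĒB̄ : ∀ {v} → VFactor v → ∀ T → restrict inĒB̄ (v ++ T) ≡ ē ∷ restrict inĒB̄ T
vFactor-ĒB̄ ē-end T = refl
vFactor-ĒB̄ (b-step f) T = vFactor-ĒB̄ f T

vFactor-EB̄ : ∀ {v} → VFactor v → ∀ T → restrict inEB̄ (v ++ T) ≡ restrict inEB̄ T
vFactor-EB̄ ē-end T = refl
vFactor-EB̄ (b-step f) T = vFactor-EB̄ f T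

vFactor-EĒ : ∀ {v} → VFactor v → ∀ T → restrict inEĒ (v ++ T) ≡ ē ∷ restrict inEĒ T
vFactor-EĒ ē-end T = refl
vFactor-EĒ (b-step f) T = vFactor-EĒ f T

vFactor-closedBy : ∀ {v} → VFactor v → ∀ {T} → ClosedBy ē (v ++ T)
vFactor-closedBy ē-end = immediately
vFactor-closedBy (b-step f) = later b-opens (vFactor-closedBy f)

vFactor-blocked : ∀ {v} → VFactor v → ∀ {T} → Blocked T → Blocked (v ++ T)
vFactor-blocked ē-end bl = close-ē bl
vFactor-blocked (b-step f) bl = open-b (vFactor-closedBy f) (vFactor-blocked f bl)

record WellSubstituted (W : Word) (us vs : List Word) : Set where
  field
    restrict-EB̄ : restrict inEB̄ (substitute W us vs) ≡ concat us
    restrict-ĒB̄ : restrict inĒB̄ (substitute W us vs) ≡ W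
    restrict-ĒB : restrict inĒB (substitute W us vs) ≡ concat vs
    blocked     : Blocked (substitute W us vs)

substitute-wellSubstituted : ∀ q {us vs} → All UFactor us → All VFactor vs →
  length us ≡ countRight q → length vs ≡ countUp q → WellSubstituted (map enc2 q) us vs
substitute-wellSubstituted [] [] [] _ _ = record
  { restrict-EB̄ = refl ; restrict-ĒB̄ = refl ; restrict-ĒB = refl ; blocked = [] }
substitute-wellSubstituted (right ∷ q) {u ∷ us} (fu ∷ fus) fvs lu lv = record
  { restrict-EB̄ = trans (uFactor-EB̄ fu _) (cong (u ++_) restrict-EB̄)
  ; restrict-ĒB̄ = trans (uFactor-ĒB̄ fu _) (cong (b̄ ∷_) restrict-ĒB̄)
  ; restrict-ĒB = trans (uFactor-ĒB fu _) restrict-ĒB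
  ; blocked     = uFactor-blocked fu blocked
  }
  where open WellSubstituted (substitute-wellSubstituted q fus fvs (suc-injective lu) lv)
substitute-wellSubstituted (up ∷ q) {vs = v ∷ vs} fus (fv ∷ fvs) lu lv = record
  { restrict-EB̄ = trans (vFactor-EB̄ fv _) restrict-EB̄
  ; restrict-ĒB̄ = trans (vFactor-ĒB̄ fv _) (cong (ē ∷_) restrict-ĒB̄)
  ; restrict-ĒB = trans (vFactor-ĒB fv _) (cong (v ++_) restrict-ĒB)
  ; blocked     = vFactor-blocked fv blocked
  }
  where open WellSubstituted (substitute-wellSubstituted q fus fvs lu (suc-injective lv))

uSplit : List Step → Word × List Word
uSplit [] = [ b̄ ] , []
uSplit (up ∷ p) = map₁ (e ∷_) (uSplit p)
uSplit (right ∷ p) = [ b̄ ] , uncurry _∷_ (uSplit p)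

vSplit : List Step → Word × List Word
vSplit [] = [ ē ] , []
vSplit (right ∷ p) = map₁ (b ∷_) (vSplit p)
vSplit (up ∷ p) = [ ē ] , uncurry _∷_ (vSplit p)

uFactors′ vFactors′ : List Step → List Word
uFactors′ p = uncurry _∷_ (uSplit p)
vFactors′ p = uncurry _∷_ (vSplit p)

uFactors≡uFactors′ : ∀ p → uFactors p ≡ uFactors′ p
uFactors≡uFactors′ [] = refl
uFactors≡uFactors′ (up ∷ p) =
  trans (factors-∷ isB̄ e (map enc1 p ++ [ b̄ ]) refl) (cong (consHead e) (uFactors≡uFactors′ p))
uFactors≡uFactors′ (right ∷ p) = cong ([ b̄ ] ∷_) (uFactors≡uFactors′ p)

vFactors≡vFactors′ : ∀ p → vFactors p ≡ vFactors′ p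
vFactors≡vFactors′ [] = refl
vFactors≡vFactors′ (right ∷ p) =
  trans (factors-∷ isĒ b (map enc3 p ++ [ ē ]) refl) (cong (consHead b) (vFactors≡vFactors′ p))
vFactors≡vFactors′ (up ∷ p) = cong ([ ē ] ∷_) (vFactors≡vFactors′ p)

uFactors′-shape : ∀ p → All UFactor (uFactors′ p)
uFactors′-shape [] = b̄-end ∷ []
uFactors′-shape (up ∷ p) with fu ∷ fus ← uFactors′-shape p = e-step fu ∷ fus
uFactors′-shape (right ∷ p) = b̄-end ∷ uFactors′-shape p

vFactors′-shape : ∀ p → All VFactor (vFactors′ p)
vFactors′-shape [] = ē-end ∷ []
vFactors′-shape (right ∷ p) with fv ∷ fvs ← vFactors′-shape p = b-step fv ∷ fvs
vFactors′-shape (up ∷ p) = ē-end ∷ vFactors′-shape p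

length-uFactors′ : ∀ p → length (uFactors′ p) ≡ suc (countRight p)
length-uFactors′ [] = refl
length-uFactors′ (up ∷ p) = length-uFactors′ p
length-uFactors′ (right ∷ p) = cong suc (length-uFactors′ p)

length-vFactors′ : ∀ p → length (vFactors′ p) ≡ suc (countUp p)
length-vFactors′ [] = refl
length-vFactors′ (right ∷ p) = length-vFactors′ p
length-vFactors′ (up ∷ p) = cong suc (length-vFactors′ p)

-- Non-meeting paths give Dyck walks

pointsAfter : ℤ × ℤ → List Step → List (ℤ × ℤ)
pointsAfter s p = drop 1 (points s p)

start-∈-points : ∀ s p → s ∈ points s p
start-∈-points s [] = here refl
start-∈-points s (up ∷ p) = here refl
start-∈-points s (right ∷ p) = here refl

pointsAfter⊆points : ∀ {pt} s p → pt ∈ pointsAfter s p → pt ∈ points s p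
pointsAfter⊆points s (up ∷ p) pt∈ = there pt∈
pointsAfter⊆points s (right ∷ p) pt∈ = there pt∈

+1-+suc : ∀ y h → (y +ℤ + 1) +ℤ + suc h ≡ y +ℤ + suc (suc h)
+1-+suc y h = ℤ.+-assoc y (+ 1) (+ suc h)

+suc-+1 : ∀ y h → (y +ℤ + suc h) +ℤ + 1 ≡ y +ℤ + suc (suc h)
+suc-+1 y h = trans (ℤ.+-assoc y (+ suc h) (+ 1)) (cong (λ n → y +ℤ + suc n) (+-comm h 1))

fall-ē : ∀ {h W us vs} → All VFactor vs →
  DyckFrom e ē h (restrict inEĒ (substitute W us (drop 1 vs))) →
  DyckFrom e ē (suc h) (restrict inEĒ (substitute (ē ∷ W) us vs))
fall-ē [] p = fall p
fall-ē {W = W} {us} {vs = _ ∷ vs} (fv ∷ _) p rewrite vFactor-EĒ fv (substitute W us vs) = fall p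

fall-b̄ : ∀ {h W us vs} → All UFactor us →
  DyckFrom b b̄ h (restrict inBB̄ (substitute W (drop 1 us) vs)) →
  DyckFrom b b̄ (suc h) (restrict inBB̄ (substitute (b̄ ∷ W) us vs))
fall-b̄ [] p = fall p
fall-b̄ {W = W} {us = _ ∷ us} {vs} (fu ∷ _) p rewrite uFactor-BB̄ fu (substitute W us vs) = fall p

dyckEĒ-ups : ∀ q {vs} → countRight q ≡ 0 → All VFactor vs →
  DyckFrom e ē (countUp q) (restrict inEĒ (substitute (map enc2 q) [] vs))
dyckEĒ-ups [] _ _ = []
dyckEĒ-ups (up ∷ q) rights fvs = fall-ē fvs (dyckEĒ-ups q rights (drop⁺ 1 fvs))

dyckBB̄-rights : ∀ q {us} → countUp q ≡ 0 → All UFactor us →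
  DyckFrom b b̄ (countRight q) (restrict inBB̄ (substitute (map enc2 q) us []))
dyckBB̄-rights [] _ _ = []
dyckBB̄-rights (right ∷ q) ups fus = fall-b̄ fus (dyckBB̄-rights q ups (drop⁺ 1 fus))

-- h + 1 is the vertical gap between p̃¹ at height y₁ and p̃² at height y₂ in the current column:
-- the walk falls when p̃² moves up (a zero gap would make the paths meet), and rises while p̃¹
-- catches up with p̃² after p̃² has moved to the next column.  The {b, b̄} walk is the transpose.
mutual
  dyckEĒ-column : ∀ {x y₁ y₂} h q₁ q₂ {vs} → All VFactor vs →
    Disjoint (points (x , y₁) q₁) (pointsAfter (x , y₂) q₂) →
    y₁ ≡ y₂ +ℤ + suc h → countRight q₂ ≡ suc (countRight q₁) → h + countUp q₁ ≡ countUp q₂ →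
    DyckFrom e ē h (restrict inEĒ (substitute (map enc2 q₂) (uFactors′ q₁) vs))
  dyckEĒ-column zero q₁ (up ∷ q₂) _ disjoint refl _ _ =
    ⊥-elim (disjoint _ (start-∈-points _ q₁) (start-∈-points _ q₂))
  dyckEĒ-column {y₂ = y₂} (suc h) q₁ (up ∷ q₂) fvs disjoint gap rights ups =
    fall-ē fvs (dyckEĒ-column h q₁ q₂ (drop⁺ 1 fvs)
      (λ pt pt∈₁ pt∈₂ → disjoint pt pt∈₁ (pointsAfter⊆points _ q₂ pt∈₂))
      (trans gap (sym (+1-+suc y₂ h))) rights (suc-injective ups))
  dyckEĒ-column h q₁ (right ∷ q₂) fvs disjoint gap rights ups =
    dyckEĒ-catchUp h q₁ q₂ fvs (λ pt pt∈₁ pt∈₂ → disjoint pt pt∈₁ (pointsAfter⊆points _ q₂ pt∈₂))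
      gap (suc-injective rights) ups

  dyckEĒ-catchUp : ∀ {x y₁ y₂} h q₁ q₂ {vs} → All VFactor vs →
    Disjoint (points (x , y₁) q₁) (pointsAfter (x +ℤ + 1 , y₂) q₂) →
    y₁ ≡ y₂ +ℤ + suc h → countRight q₂ ≡ countRight q₁ → h + countUp q₁ ≡ countUp q₂ →
    DyckFrom e ē h (restrict inEĒ (substitute (b̄ ∷ map enc2 q₂) (uFactors′ q₁) vs))
  dyckEĒ-catchUp h [] q₂ fvs _ _ rights ups =
    subst (λ n → DyckFrom e ē n _) (trans (sym ups) (+-identityʳ h)) (dyckEĒ-ups q₂ rights fvs)
  dyckEĒ-catchUp {y₂ = y₂} h (up ∷ q₁) q₂ fvs disjoint gap rights ups =
    rise (dyckEĒ-catchUp (suc h) q₁ q₂ fvs (λ pt pt∈₁ → disjoint pt (there pt∈₁))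
      (trans (cong (_+ℤ + 1) gap) (+suc-+1 y₂ h)) rights (trans (sym (+-suc h _)) ups))
  dyckEĒ-catchUp h (right ∷ q₁) q₂ fvs disjoint gap rights ups =
    dyckEĒ-column h q₁ q₂ fvs (λ pt pt∈₁ → disjoint pt (there pt∈₁)) gap rights ups

mutual
  dyckBB̄-row : ∀ {x₂ x₃ y} h q₃ q₂ {us} → All UFactor us →
    Disjoint (points (x₃ , y) q₃) (pointsAfter (x₂ , y) q₂) →
    x₃ ≡ x₂ +ℤ + suc h → countUp q₂ ≡ suc (countUp q₃) → h + countRight q₃ ≡ countRight q₂ →
    DyckFrom b b̄ h (restrict inBB̄ (substitute (map enc2 q₂) us (vFactors′ q₃)))
  dyckBB̄-row zero q₃ (right ∷ q₂) _ disjoint refl _ _ =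
    ⊥-elim (disjoint _ (start-∈-points _ q₃) (start-∈-points _ q₂))
  dyckBB̄-row {x₂ = x₂} (suc h) q₃ (right ∷ q₂) fus disjoint gap ups rights =
    fall-b̄ fus (dyckBB̄-row h q₃ q₂ (drop⁺ 1 fus)
      (λ pt pt∈₃ pt∈₂ → disjoint pt pt∈₃ (pointsAfter⊆points _ q₂ pt∈₂))
      (trans gap (sym (+1-+suc x₂ h))) ups (suc-injective rights))
  dyckBB̄-row h q₃ (up ∷ q₂) fus disjoint gap ups rights =
    dyckBB̄-catchUp h q₃ q₂ fus (λ pt pt∈₃ pt∈₂ → disjoint pt pt∈₃ (pointsAfter⊆points _ q₂ pt∈₂))
      gap (suc-injective ups) rights

  dyckBB̄-catchUp : ∀ {x₂ x₃ y} h q₃ q₂ {us} → All UFactor us →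
    Disjoint (points (x₃ , y) q₃) (pointsAfter (x₂ , y +ℤ + 1) q₂) →
    x₃ ≡ x₂ +ℤ + suc h → countUp q₂ ≡ countUp q₃ → h + countRight q₃ ≡ countRight q₂ →
    DyckFrom b b̄ h (restrict inBB̄ (substitute (ē ∷ map enc2 q₂) us (vFactors′ q₃)))
  dyckBB̄-catchUp h [] q₂ fus _ _ ups rights =
    subst (λ n → DyckFrom b b̄ n _) (trans (sym rights) (+-identityʳ h)) (dyckBB̄-rights q₂ ups fus)
  dyckBB̄-catchUp {x₂ = x₂} h (right ∷ q₃) q₂ fus disjoint gap ups rights =
    rise (dyckBB̄-catchUp (suc h) q₃ q₂ fus (λ pt pt∈₃ → disjoint pt (there pt∈₃))
      (trans (cong (_+ℤ + 1) gap) (+suc-+1 x₂ h)) ups (trans (sym (+-suc h _)) rights))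
  dyckBB̄-catchUp h (up ∷ q₃) q₂ fus disjoint gap ups rights =
    dyckBB̄-row h q₃ q₂ fus (λ pt pt∈₃ → disjoint pt (there pt∈₃)) gap ups rights

good-explicit : ∀ {i j p1 p2 p3} → InP i j p1 p2 p3 →
  Good p1 p2 p3 (e ∷ b ∷ substitute (w² p2) (uFactors′ p1) (vFactors′ p3))
good-explicit {p1 = p1} {p2} {p3} inP =
  compatible , (_ , refl) , dyckFrom-isDyck refl refl dyckEĒ , dyckFrom-isDyck refl refl dyckBB̄ ,
  separated-∷ (λ ()) (blocked-separated-b blocked-bW) , cond5-∷ (blocked-separated-e blocked-bW)
  where
  open InP inP
  W : Word
  W = substitute (w² p2) (uFactors′ p1) (vFactors′ p3)
  open WellSubstituted (substitute-wellSubstituted (up ∷ right ∷ p2)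
    (uFactors′-shape p1) (vFactors′-shape p3)
    (trans (length-uFactors′ p1) (cong suc (trans right1 (sym right2))))
    (trans (length-vFactors′ p3) (cong suc (trans up3 (sym up2)))))
  concat-uFactors′ : concat (uFactors′ p1) ≡ map enc1 p1 ++ [ b̄ ]
  concat-uFactors′ = trans (cong concat (sym (uFactors≡uFactors′ p1))) (concat-factors isB̄ _)
  concat-vFactors′ : concat (vFactors′ p3) ≡ map enc3 p3 ++ [ ē ]
  concat-vFactors′ = trans (cong concat (sym (vFactors≡vFactors′ p3))) (concat-factors isĒ _)
  compatible : Compatible p1 p2 p3 (e ∷ b ∷ W)
  compatible = cong (e ∷_) (trans restrict-EB̄ concat-uFactors′) , restrict-ĒB̄ ,
               cong (b ∷_) (trans restrict-ĒB concat-vFactors′)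
  dyckEĒ : DyckFrom e ē 0 (restrict inEĒ (e ∷ b ∷ W))
  dyckEĒ = rise (fall-ē {W = b̄ ∷ map enc2 p2} {uFactors′ p1} (vFactors′-shape p3)
    (dyckEĒ-catchUp 0 p1 p2 (drop⁺ 1 (vFactors′-shape p3))
      (λ pt pt∈₁ pt∈₂ → disj12 pt pt∈₁ (pointsAfter⊆points _ p2 pt∈₂))
      refl (trans right2 (sym right1)) (trans up1 (sym up2))))
  -- The leading b̄ of w² is read as a right step of p̃² from (-1, 0) to its start (0, 0).
  dyckBB̄ : DyckFrom b b̄ 0 (restrict inBB̄ (e ∷ b ∷ W))
  dyckBB̄ = rise (dyckBB̄-catchUp {x₂ = -[1+ 0 ]} 1 p3 (right ∷ p2) (uFactors′-shape p1)
    (λ pt pt∈₃ pt∈₂ → disj23 pt pt∈₂ pt∈₃)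
    refl (trans up2 (sym up3)) (cong suc (trans right3 (sym right2))))
  blocked-bW : Blocked (b ∷ W)
  blocked-bW = open-b (vFactor-closedBy (All.head (vFactors′-shape p3))) blocked

proposition4p6 : (i j : ℕ) → 1 ≤ i → 1 ≤ j →
    (p1 p2 p3 : List Step) → InP i j p1 p2 p3 →
    Good p1 p2 p3 (wOf p1 p2 p3) ×
    (∀ (w′ : Word) → Good p1 p2 p3 w′ → w′ ≡ wOf p1 p2 p3)
proposition4p6 i j _ _ p1 p2 p3 inP =
  subst (Good p1 p2 p3) explicit≡wOf (good-explicit inP) , λ _ → good-unique
  where
  explicit≡wOf : e ∷ b ∷ substitute (w² p2) (uFactors′ p1) (vFactors′ p3) ≡ wOf p1 p2 p3
  explicit≡wOf = cong₂ (λ us vs → e ∷ b ∷ substitute (w² p2) us vs)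
    (sym (uFactors≡uFactors′ p1)) (sym (vFactors≡vFactors′ p3))
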